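{- Let $A$ be an arbitrary $n\times m$ binary matrix. (a) If $s\ge1$ and $X_1,X_2,\dots,X_s\in\mathcal{T}_n$ are such that $$r(X_1X_2\cdots X_sA)<r(X_2X_3\cdots X_sA)<\cdots<r(X_sA)<r(A),$$ then $c(X_1X_2\cdots X_sA)<c(A)$. (b) If $t\ge1$ and $Y_1,Y_2,\dots,Y_t\in\mathcal{T}_m$ are such that $$c(AY_1Y_2\cdots Y_t)<c(AY_2Y_3\cdots Y_t)<\cdots<c(AY_t)<c(A),$$ then $r(AY_1Y_2\cdots Y_t)<r(A)$.
   Context: A binary matrix is a matrix with entries in $\{0,1\}$. For an $n\times m$ binary matrix $A=[a_{ij}]$, $r(A)=\langle x_1,\dots,x_n\rangle$ with $x_i=\sum_{j=1}^m a_{ij}2^{m-j}$ (the integer whose binary representation is row $i$, column 1 being the most significant bit), and $c(A)=\langle y_1,\dots,y_m\rangle$ with $y_j=\sum_{i=1}^n a_{ij}2^{n-i}$ (the integer whose binary representation is column $j$, row 1 being the most significant bit). Tuples of integers are compared by the lexicographic order, denoted $<$. $\mathcal{T}_k$ denotes the set of $k\times k$ permutation matrices corresponding to transpositions, i.e. those which, multiplied from the left onto a $k\times m$ matrix, swap exactly two rows (equivalently, multiplied from the right onto an $n\times k$ matrix, swap exactly two columns). -}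

module Defs where

open import Data.Nat using (ℕ; zero; suc; _+_; _*_; _^_; _<_; _∸_)
open import Data.Fin using (Fin; toℕ; _≟_)
open import Data.List using (List; []; _∷_; map)
open import Data.Vec.Functional using (foldr)
open import Data.Product using (_×_; ∃-syntax)
open import Data.Sum using (_⊎_)
open import Data.Unit using (⊤)
open import Data.Bool using (if_then_else_)
open import Relation.Nullary using (¬_; does)
open import Relation.Binary.PropositionalEquality using (_≡_)
open import Data.List.Relation.Binary.Lex.Strict using (Lex-<)
open import Data.List using (allFin)
  renaming (map to lmap)

Matrix : ℕ → ℕ → Set
Matrix n m = Fin n → Fin m → ℕ

IsBinary : ∀ {n m} → Matrix n m → Set
IsBinary {n} {m} A = ∀ (i : Fin n) (j : Fin m) → (A i j ≡ 0) ⊎ (A i j ≡ 1)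

sumFin : ∀ {n} → (Fin n → ℕ) → ℕ
sumFin = foldr _+_ 0

_⊗_ : ∀ {n k m} → Matrix n k → Matrix k m → Matrix n m
(A ⊗ B) i j = sumFin (λ l → A i l * B l j)
infixr 7 _⊗_

swapFin : ∀ {k} → Fin k → Fin k → Fin k → Fin k
swapFin p q i = if does (i ≟ p) then q else (if does (i ≟ q) then p else i)

transpositionMatrix : ∀ {k} → Fin k → Fin k → Matrix k k
transpositionMatrix p q i j = if does (j ≟ swapFin p q i) then 1 else 0

InT : ∀ k → Matrix k k → Set
InT k X = ∃[ p ] ∃[ q ] (¬ p ≡ q × (∀ i j → X i j ≡ transpositionMatrix p q i j))

bitsVal : List ℕ → ℕ
bitsVal = Data.List.foldl (λ acc b → 2 * acc + b) 0
  where import Data.List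

-- r(A) = ⟨x_1,…,x_n⟩, x_i = Σ_j a_ij 2^(m-j)
r : ∀ {n m} → Matrix n m → List ℕ
r {n} {m} A = lmap (λ i → bitsVal (lmap (λ j → A i j) (allFin m))) (allFin n)

-- c(A) = ⟨y_1,…,y_m⟩, y_j = Σ_i a_ij 2^(n-i)
c : ∀ {n m} → Matrix n m → List ℕ
c {n} {m} A = lmap (λ j → bitsVal (lmap (λ i → A i j) (allFin n))) (allFin m)

_<ₗ_ : List ℕ → List ℕ → Set
_<ₗ_ = Lex-< _≡_ _<_

lprod : ∀ {n m} → List (Matrix n n) → Matrix n m → Matrix n m
lprod [] A = A
lprod (X ∷ Xs) A = X ⊗ lprod Xs A

mprodNE : ∀ {m} → Matrix m m → List (Matrix m m) → Matrix m m
mprodNE Y [] = Y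
mprodNE Y (Z ∷ Zs) = Y ⊗ mprodNE Z Zs

rprod : ∀ {n m} → Matrix n m → List (Matrix m m) → Matrix n m
rprod A [] = A
rprod A (Y ∷ Ys) = A ⊗ mprodNE Y Ys

RowChain : ∀ {n m} → List (Matrix n n) → Matrix n m → Set
RowChain [] A = ⊤
RowChain (X ∷ Xs) A = (r (lprod (X ∷ Xs) A) <ₗ r (lprod Xs A)) × RowChain Xs A

ColChain : ∀ {n m} → Matrix n m → List (Matrix m m) → Set
ColChain A [] = ⊤
ColChain A (Y ∷ Ys) = (c (rprod A (Y ∷ Ys)) <ₗ c (rprod A Ys)) × ColChain A Ys

module Submission where

-- A row transposition τ that decreases r must move the first row k it changes downwards
-- (to τ k > k), and row τ k < row k as binary numbers: at the first column j where these
-- rows differ, row τ k has a 0 and row k a 1. Columns before j are untouched by the swap,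
-- while column j keeps its entries above row k and has its k-th bit drop from 1 to 0, so c
-- decreases. Part (b) is the transposed statement, because A Y₁Y₂⋯Y_t is A Y₂⋯Y_t with two
-- columns swapped (by the conjugate of Y₁ under Y₂⋯Y_t). Chains follow by transitivity,
-- transpositions preserving binarity.

open import Defs
open import Data.Bool using (if_then_else_)
open import Data.Fin as Fin using (Fin; _≟_) renaming (zero to fzero; suc to fsuc)
import Data.Fin.Properties as Finₚ
open import Data.Fin.Permutation
  using (Permutation′; permutation; _∘ₚ_; _⟨$⟩ʳ_; _⟨$⟩ˡ_; inverseˡ; inverseʳ) renaming (id to idₚ)
open import Data.List using (List; []; _∷_; tabulate; foldl)
open import Data.List.Properties using (map-tabulate; tabulate-cong)
open import Data.List.Relation.Binary.Lex.Strict using (base; this; next; <-compare; <-transitive)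
open import Data.List.Relation.Binary.Pointwise using (Pointwise-≡⇒≡)
open import Data.List.Relation.Unary.All using (All; []; _∷_)
open import Data.Nat using (ℕ; zero; suc; _+_; _*_; _^_; _<_; z<s; s≤s)
open import Data.Nat.Properties
  using (module ≤-Reasoning; +-0-commutativeMonoid; +-identityʳ; *-identityʳ; *-identityˡ; *-zeroʳ;
         m≤m+n; +-monoʳ-<; <-≤-trans; <-cmp; <-trans; <⇒≢; >⇒≢; <⇒≯)
open import Data.Nat.Solver using (module +-*-Solver)
open import Algebra.Properties.CommutativeMonoid.Sum +-0-commutativeMonoid
  using (sum; sum-remove; sum-cong-≗; sum-replicate-zero)
open import Data.Product using (_×_; _,_; ∃-syntax; ∃₂; proj₁; proj₂)
open import Data.Sum using (_⊎_; inj₁; inj₂)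
open import Data.Vec.Functional using (removeAt; replicate)
open import Function using (_∘_; id)
open import Relation.Binary.Definitions using (tri<; tri≈; tri>)
open import Relation.Binary.PropositionalEquality
open import Relation.Nullary using (contradiction; yes; no; does)
open import Relation.Nullary.Decidable using (dec-true; dec-false)

Bit : ℕ → Set
Bit b = b ≡ 0 ⊎ b ≡ 1

Bits : ∀ {n} → (Fin n → ℕ) → Set
Bits f = ∀ i → Bit (f i)

value : ∀ {n} → (Fin n → ℕ) → ℕ
value f = bitsVal (tabulate f)

foldl-doubling : ∀ {n} (f : Fin n → ℕ) a →
  foldl (λ acc b → 2 * acc + b) a (tabulate f) ≡ a * 2 ^ n + value f
foldl-doubling {zero}  f a = sym (trans (+-identityʳ _) (*-identityʳ a))
foldl-doubling {suc n} f a = begin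
  foldl _ (2 * a + f₀) (tabulate (f ∘ fsuc))  ≡⟨ foldl-doubling (f ∘ fsuc) (2 * a + f₀) ⟩
  (2 * a + f₀) * 2 ^ n + v                   ≡⟨ solve 4 (λ a b p v → (con 2 :* a :+ b) :* p :+ v
                                                             := a :* (con 2 :* p) :+ (b :* p :+ v))
                                                  refl a f₀ (2 ^ n) v ⟩
  a * 2 ^ suc n + (f₀ * 2 ^ n + v)           ≡⟨ cong (a * 2 ^ suc n +_) (foldl-doubling (f ∘ fsuc) f₀) ⟨
  a * 2 ^ suc n + value f                    ∎
  where
  open ≡-Reasoning
  open +-*-Solver
  f₀ = f fzero
  v  = value (f ∘ fsuc)

value-suc : ∀ {n} (f : Fin (suc n) → ℕ) → value f ≡ f fzero * 2 ^ n + value (f ∘ fsuc)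
value-suc f = foldl-doubling (f ∘ fsuc) (f fzero)

value<2^n : ∀ {n} {f : Fin n → ℕ} → Bits f → value f < 2 ^ n
value<2^n {zero} bits = z<s
value<2^n {suc n} {f} bits rewrite value-suc f with bits fzero
... | inj₁ f0≡0 rewrite f0≡0 = <-≤-trans (value<2^n (bits ∘ fsuc)) (m≤m+n _ _)
... | inj₂ f0≡1 rewrite f0≡1 | +-identityʳ (2 ^ n) = +-monoʳ-< (2 ^ n) (value<2^n (bits ∘ fsuc))

bit-< : ∀ {a b} → Bit a → Bit b → a < b → a ≡ 0 × b ≡ 1
bit-< (inj₁ refl) (inj₂ refl) _ = refl , refl
bit-< _ (inj₁ refl) ()
bit-< (inj₂ refl) (inj₂ refl) (s≤s ())

<ₗ⇒value< : ∀ {n} {f g : Fin n → ℕ} → Bits f → Bits g → tabulate f <ₗ tabulate g → value f < value g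
<ₗ⇒value< {zero} _ _ (base ())
<ₗ⇒value< {suc n} {f} {g} bf bg (this f0<g0) with bit-< (bf fzero) (bg fzero) f0<g0
... | f0≡0 , g0≡1 = begin-strict
  value f                             ≡⟨ value-suc f ⟩
  f fzero * 2 ^ n + value (f ∘ fsuc)  ≡⟨ cong (λ b → b * 2 ^ n + value (f ∘ fsuc)) f0≡0 ⟩
  value (f ∘ fsuc)                    <⟨ value<2^n (bf ∘ fsuc) ⟩
  2 ^ n                               ≡⟨ *-identityˡ (2 ^ n) ⟨
  1 * 2 ^ n                           ≤⟨ m≤m+n (1 * 2 ^ n) (value (g ∘ fsuc)) ⟩
  1 * 2 ^ n + value (g ∘ fsuc)        ≡⟨ cong (λ b → b * 2 ^ n + value (g ∘ fsuc)) g0≡1 ⟨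
  g fzero * 2 ^ n + value (g ∘ fsuc)  ≡⟨ value-suc g ⟨
  value g                             ∎
  where open ≤-Reasoning
<ₗ⇒value< {suc n} {f} {g} bf bg (next f0≡g0 rest) rewrite value-suc f | value-suc g | f0≡g0 =
  +-monoʳ-< (g fzero * 2 ^ n) (<ₗ⇒value< (bf ∘ fsuc) (bg ∘ fsuc) rest)

value<⇒<ₗ : ∀ {n} {f g : Fin n → ℕ} → Bits f → Bits g → value f < value g → tabulate f <ₗ tabulate g
value<⇒<ₗ {f = f} {g} bf bg vf<vg with <-compare sym <-cmp (tabulate f) (tabulate g)
... | tri< f<g _ _ = f<g
... | tri≈ _ f≈g _ = contradiction (cong bitsVal (Pointwise-≡⇒≡ f≈g)) (<⇒≢ vf<vg)
... | tri> _ _ g<f = contradiction (<ₗ⇒value< bg bf g<f) (<⇒≯ vf<vg)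

_≺_ : ∀ {n} → (Fin n → ℕ) → (Fin n → ℕ) → Set
f ≺ g = ∃[ k ] (∀ i → i Fin.< k → f i ≡ g i) × f k < g k

≺⇒tabulate-<ₗ : ∀ {n} {f g : Fin n → ℕ} → f ≺ g → tabulate f <ₗ tabulate g
≺⇒tabulate-<ₗ (fzero , _ , fk<gk) = this fk<gk
≺⇒tabulate-<ₗ (fsuc k , agree , fk<gk) =
  next (agree fzero z<s) (≺⇒tabulate-<ₗ (k , (λ i i<k → agree (fsuc i) (s≤s i<k)) , fk<gk))

tabulate-<ₗ⇒≺ : ∀ {n} {f g : Fin n → ℕ} → tabulate f <ₗ tabulate g → f ≺ g
tabulate-<ₗ⇒≺ {zero} (base ())
tabulate-<ₗ⇒≺ {suc n} (this f0<g0) = fzero , (λ _ ()) , f0<g0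
tabulate-<ₗ⇒≺ {suc n} {f} {g} (next f0≡g0 rest) with tabulate-<ₗ⇒≺ rest
... | k , agree , fk<gk = fsuc k , agree′ , fk<gk
  where
  agree′ : ∀ i → i Fin.< fsuc k → f i ≡ g i
  agree′ fzero    _         = f0≡g0
  agree′ (fsuc i) (s≤s i<k) = agree i i<k

record Swaps {n} (τ : Fin n → Fin n) (p q : Fin n) : Set where
  field
    sends-p    : τ p ≡ q
    sends-q    : τ q ≡ p
    fixes-rest : ∀ i → i ≢ p → i ≢ q → τ i ≡ i

open Swaps

swapFin-swaps : ∀ {n} (p q : Fin n) → Swaps (swapFin p q) p q
swapFin-swaps p q = record { sends-p = sends-p′ ; sends-q = sends-q′ ; fixes-rest = fixes-rest′ }
  where
  sends-p′ : swapFin p q p ≡ q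
  sends-p′ rewrite dec-true (p ≟ p) refl = refl
  sends-q′ : swapFin p q q ≡ p
  sends-q′ with q ≟ p
  ... | yes q≡p = q≡p
  ... | no _ rewrite dec-true (q ≟ q) refl = refl
  fixes-rest′ : ∀ i → i ≢ p → i ≢ q → swapFin p q i ≡ i
  fixes-rest′ i i≢p i≢q rewrite dec-false (i ≟ p) i≢p | dec-false (i ≟ q) i≢q = refl

Swaps-sym : ∀ {n} {τ : Fin n → Fin n} {p q} → Swaps τ p q → Swaps τ q p
Swaps-sym s = record { sends-p = sends-q s ; sends-q = sends-p s ; fixes-rest = λ i i≢q i≢p → fixes-rest s i i≢p i≢q }

Swaps-involutive : ∀ {n} {τ : Fin n → Fin n} {p q} → Swaps τ p q → ∀ i → τ (τ i) ≡ i
Swaps-involutive {τ = τ} {p} {q} s i with i ≟ p | i ≟ q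
... | yes refl | _        = trans (cong τ (sends-p s)) (sends-q s)
... | no _     | yes refl = trans (cong τ (sends-q s)) (sends-p s)
... | no i≢p   | no i≢q   = trans (cong τ (fixes-rest s i i≢p i≢q)) (fixes-rest s i i≢p i≢q)

Swaps-moved : ∀ {n} {τ : Fin n → Fin n} {p q k} → Swaps τ p q → τ k ≢ k → Swaps τ k (τ k)
Swaps-moved {p = p} {q} {k} s τk≢k with k ≟ p | k ≟ q
... | yes refl | _        rewrite sends-p s = s
... | no _     | yes refl rewrite sends-q s = Swaps-sym s
... | no k≢p   | no k≢q   = contradiction (fixes-rest s k k≢p k≢q) τk≢k

Swaps-invariant : ∀ {n} {A : Set} {τ : Fin n → Fin n} {p q} (f : Fin n → A) →
  Swaps τ p q → f p ≡ f q → ∀ i → f (τ i) ≡ f i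
Swaps-invariant {τ = τ} {p} {q} f s fp≡fq i with i ≟ p | i ≟ q
... | yes refl | _        = trans (cong f (sends-p s)) (sym fp≡fq)
... | no _     | yes refl = trans (cong f (sends-q s)) fp≡fq
... | no i≢p   | no i≢q   = cong f (fixes-rest s i i≢p i≢q)

Swaps-conjugate : ∀ {n} {τ : Fin n → Fin n} {p q} (π : Permutation′ n) → Swaps τ p q →
  Swaps (λ j → π ⟨$⟩ʳ τ (π ⟨$⟩ˡ j)) (π ⟨$⟩ʳ p) (π ⟨$⟩ʳ q)
Swaps-conjugate {τ = τ} π s = record
  { sends-p    = trans (cong (λ i → π ⟨$⟩ʳ τ i) (inverseˡ π)) (cong (π ⟨$⟩ʳ_) (sends-p s))
  ; sends-q    = trans (cong (λ i → π ⟨$⟩ʳ τ i) (inverseˡ π)) (cong (π ⟨$⟩ʳ_) (sends-q s))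
  ; fixes-rest = λ j j≢πp j≢πq → trans
      (cong (π ⟨$⟩ʳ_) (fixes-rest s (π ⟨$⟩ˡ j) (j≢πp ∘ moved-back) (j≢πq ∘ moved-back))) (inverseʳ π)
  }
  where
  moved-back : ∀ {j i} → π ⟨$⟩ˡ j ≡ i → j ≡ π ⟨$⟩ʳ i
  moved-back {j} π⁻¹j≡i = trans (sym (inverseʳ π)) (cong (π ⟨$⟩ʳ_) π⁻¹j≡i)

IsTransposition : ∀ {n} → (Fin n → Fin n) → Set
IsTransposition τ = ∃₂ λ p q → Swaps τ p q

first-difference-moves-up : ∀ {n} {τ : Fin n → Fin n} {g : Fin n → ℕ} {k} → (∀ i → τ (τ i) ≡ i) →
  (∀ i → i Fin.< k → g (τ i) ≡ g i) → g (τ k) < g k → k Fin.< τ k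
first-difference-moves-up {τ = τ} {g} {k} involutive agree gτk<gk with Finₚ.<-cmp k (τ k)
... | tri< k<τk _ _ = k<τk
... | tri≈ _ k≡τk _ = contradiction (cong g (sym k≡τk)) (<⇒≢ gτk<gk)
... | tri> _ _ τk<k = contradiction (trans (sym (cong g (involutive k))) (agree (τ k) τk<k)) (>⇒≢ gτk<gk)

infix 4 _≋_

_≋_ : ∀ {n m} → Matrix n m → Matrix n m → Set
A ≋ B = ∀ i j → A i j ≡ B i j

_ᵀ : ∀ {n m} → Matrix n m → Matrix m n
(A ᵀ) j i = A i j

rowValues : ∀ {n m} → Matrix n m → Fin n → ℕ
rowValues A i = value (A i)

r≡tabulate : ∀ {n m} (A : Matrix n m) → r A ≡ tabulate (rowValues A)
r≡tabulate A = trans (map-tabulate id _) (tabulate-cong (λ i → cong bitsVal (map-tabulate id (A i))))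

r-cong : ∀ {n m} {A B : Matrix n m} → A ≋ B → r A ≡ r B
r-cong {A = A} {B} A≋B = begin
  r A                     ≡⟨ r≡tabulate A ⟩
  tabulate (rowValues A)  ≡⟨ tabulate-cong (λ i → cong bitsVal (tabulate-cong (A≋B i))) ⟩
  tabulate (rowValues B)  ≡⟨ r≡tabulate B ⟨
  r B                     ∎
  where open ≡-Reasoning

c-cong : ∀ {n m} {A B : Matrix n m} → A ≋ B → c A ≡ c B
c-cong A≋B = r-cong (λ j i → A≋B i j)

r-<ₗ⇒≺ : ∀ {n m} {A B : Matrix n m} → r A <ₗ r B → rowValues A ≺ rowValues B
r-<ₗ⇒≺ {A = A} {B} = tabulate-<ₗ⇒≺ ∘ subst₂ _<ₗ_ (r≡tabulate A) (r≡tabulate B)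

≺⇒r-<ₗ : ∀ {n m} {A B : Matrix n m} → rowValues A ≺ rowValues B → r A <ₗ r B
≺⇒r-<ₗ {A = A} {B} = subst₂ _<ₗ_ (sym (r≡tabulate A)) (sym (r≡tabulate B)) ∘ ≺⇒tabulate-<ₗ

rowSwap-r-<ₗ⇒c-<ₗ : ∀ {n m} {B : Matrix n m} {τ : Fin n → Fin n} → IsBinary B → IsTransposition τ →
  r (B ∘ τ) <ₗ r B → c (B ∘ τ) <ₗ c B
rowSwap-r-<ₗ⇒c-<ₗ {B = B} {τ} binary (_ , _ , swaps) rBτ<rB
  with r-<ₗ⇒≺ {A = B ∘ τ} {B} rBτ<rB
... | k , rows-agree , row-k<
  with tabulate-<ₗ⇒≺ (value<⇒<ₗ (binary (τ k)) (binary k) row-k<)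
... | j , bits-agree , bit-j< = ≺⇒r-<ₗ {A = (B ∘ τ) ᵀ} {B ᵀ} (j , columns-agree , column-j<)
  where
  k<τk : k Fin.< τ k
  k<τk = first-difference-moves-up (Swaps-involutive swaps) rows-agree row-k<
  swaps-k : Swaps τ k (τ k)
  swaps-k = Swaps-moved swaps (Finₚ.<⇒≢ k<τk ∘ sym)
  fixed-above-k : ∀ i → i Fin.< k → τ i ≡ i
  fixed-above-k i i<k = fixes-rest swaps-k i (Finₚ.<⇒≢ i<k) (Finₚ.<⇒≢ (Finₚ.<-trans i<k k<τk))
  columns-agree : ∀ j′ → j′ Fin.< j → rowValues ((B ∘ τ) ᵀ) j′ ≡ rowValues (B ᵀ) j′
  columns-agree j′ j′<j =
    cong bitsVal (tabulate-cong (Swaps-invariant (λ i → B i j′) swaps-k (sym (bits-agree j′ j′<j))))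
  column-j< : rowValues ((B ∘ τ) ᵀ) j < rowValues (B ᵀ) j
  column-j< = <ₗ⇒value< (λ i → binary (τ i) j) (λ i → binary i j)
    (≺⇒tabulate-<ₗ (k , (λ i i<k → cong (λ i′ → B i′ j) (fixed-above-k i i<k)) , bit-j<))

columnSwap-c-<ₗ⇒r-<ₗ : ∀ {n m} {B : Matrix n m} {σ : Fin m → Fin m} → IsBinary B → IsTransposition σ →
  c (λ i j → B i (σ j)) <ₗ c B → r (λ i j → B i (σ j)) <ₗ r B
columnSwap-c-<ₗ⇒r-<ₗ binary = rowSwap-r-<ₗ⇒c-<ₗ (λ j i → binary i j)

sumFin-δ : ∀ {n} (f : Fin n → ℕ) (a : Fin n) → (∀ l → l ≢ a → f l ≡ 0) → sumFin f ≡ f a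
sumFin-δ {suc n} f a vanishes-off-a = begin
  sumFin f                  ≡⟨ sum-remove f ⟩
  f a + sum (removeAt f a)  ≡⟨ cong (f a +_) (sum-cong-≗ (λ l → vanishes-off-a _ (Finₚ.punchInᵢ≢i a l))) ⟩
  f a + sum (replicate n 0) ≡⟨ cong (f a +_) (sum-replicate-zero n) ⟩
  f a + 0                   ≡⟨ +-identityʳ (f a) ⟩
  f a                       ∎
  where open ≡-Reasoning

⊗-congˡ : ∀ {n k m} {X X′ : Matrix n k} (B : Matrix k m) → X ≋ X′ → X ⊗ B ≋ X′ ⊗ B
⊗-congˡ B X≋X′ i j = sum-cong-≗ (λ l → cong (_* B l j) (X≋X′ i l))

⊗-congʳ : ∀ {n k m} (X : Matrix n k) {B B′ : Matrix k m} → B ≋ B′ → X ⊗ B ≋ X ⊗ B′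
⊗-congʳ X B≋B′ i j = sum-cong-≗ (λ l → cong (X i l *_) (B≋B′ l j))

-- transpositionMatrix p q is permutationMatrix (swapFin p q) by definition.
permutationMatrix : ∀ {k} → (Fin k → Fin k) → Matrix k k
permutationMatrix f i j = if does (j ≟ f i) then 1 else 0

permutationMatrix-⊗ : ∀ {k m} (f : Fin k → Fin k) (B : Matrix k m) → permutationMatrix f ⊗ B ≋ B ∘ f
permutationMatrix-⊗ f B i j = trans (sumFin-δ _ (f i) off-diagonal) on-diagonal
  where
  off-diagonal : ∀ l → l ≢ f i → permutationMatrix f i l * B l j ≡ 0
  off-diagonal l l≢fi rewrite dec-false (l ≟ f i) l≢fi = refl
  on-diagonal : permutationMatrix f i (f i) * B (f i) j ≡ B (f i) j
  on-diagonal rewrite dec-true (f i ≟ f i) refl = +-identityʳ (B (f i) j)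

⊗-permutationMatrix : ∀ {n m} (B : Matrix n m) (π : Permutation′ m) →
  B ⊗ permutationMatrix (π ⟨$⟩ʳ_) ≋ λ i j → B i (π ⟨$⟩ˡ j)
⊗-permutationMatrix B π i j = trans (sumFin-δ _ (π ⟨$⟩ˡ j) off-diagonal) on-diagonal
  where
  off-diagonal : ∀ l → l ≢ π ⟨$⟩ˡ j → B i l * permutationMatrix (π ⟨$⟩ʳ_) l j ≡ 0
  off-diagonal l l≢π⁻¹j
    rewrite dec-false (j ≟ π ⟨$⟩ʳ l) (λ j≡πl → l≢π⁻¹j (trans (sym (inverseˡ π)) (cong (π ⟨$⟩ˡ_) (sym j≡πl))))
    = *-zeroʳ (B i l)
  on-diagonal : B i (π ⟨$⟩ˡ j) * permutationMatrix (π ⟨$⟩ʳ_) (π ⟨$⟩ˡ j) j ≡ B i (π ⟨$⟩ˡ j)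
  on-diagonal rewrite inverseʳ π {j} | dec-true (j ≟ j) refl = *-identityʳ (B i (π ⟨$⟩ˡ j))

transposition-⊗ : ∀ {k m} {X : Matrix k k} (B : Matrix k m) → InT k X →
  ∃[ τ ] IsTransposition τ × X ⊗ B ≋ B ∘ τ
transposition-⊗ B (p , q , _ , X≋) =
  swapFin p q , (p , q , swapFin-swaps p q) ,
  λ i j → trans (⊗-congˡ B X≋ i j) (permutationMatrix-⊗ (swapFin p q) B i j)

swapPermutation : ∀ {k} → Fin k → Fin k → Permutation′ k
swapPermutation p q = permutation (swapFin p q) (swapFin p q) involutive involutive
  where involutive = Swaps-involutive (swapFin-swaps p q)

-- Y₁⋯Y_t = permutationMatrix (permutationOf ts ⟨$⟩ʳ_); note that σ ∘ₚ π applies σ first.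
permutationOf : ∀ {k} {Xs : List (Matrix k k)} → All (InT k) Xs → Permutation′ k
permutationOf []                 = idₚ
permutationOf ((p , q , _) ∷ ts) = swapPermutation p q ∘ₚ permutationOf ts

mprodNE-≋ : ∀ {m} {Y : Matrix m m} {Ys} (ts : All (InT m) (Y ∷ Ys)) →
  mprodNE Y Ys ≋ permutationMatrix (permutationOf ts ⟨$⟩ʳ_)
mprodNE-≋ ((_ , _ , _ , Y≋) ∷ [])                   = Y≋
mprodNE-≋ {Y = Y} ((p , q , _ , Y≋) ∷ ts@(_ ∷ _)) i j =
  trans (⊗-congʳ Y (mprodNE-≋ ts) i j)
        (trans (⊗-congˡ P Y≋ i j) (permutationMatrix-⊗ (swapFin p q) P i j))
  where P = permutationMatrix (permutationOf ts ⟨$⟩ʳ_)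

rprod-≋ : ∀ {n m} (A : Matrix n m) {Ys} (ts : All (InT m) Ys) →
  rprod A Ys ≋ λ i j → A i (permutationOf ts ⟨$⟩ˡ j)
rprod-≋ A []          i j = refl
rprod-≋ A ts@(_ ∷ _) i j = trans (⊗-congʳ A (mprodNE-≋ ts) i j) (⊗-permutationMatrix A (permutationOf ts) i j)

rprod-∷ : ∀ {n m} (A : Matrix n m) {Y Ys} → All (InT m) (Y ∷ Ys) →
  ∃[ σ ] IsTransposition σ × rprod A (Y ∷ Ys) ≋ λ i j → rprod A Ys i (σ j)
rprod-∷ A {Ys = Ys} ts@((p , q , _) ∷ ts′) =
  conjugate , (π ⟨$⟩ʳ p , π ⟨$⟩ʳ q , Swaps-conjugate π (swapFin-swaps p q)) , rprod-swapped
  where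
  π = permutationOf ts′
  conjugate = λ j → π ⟨$⟩ʳ swapFin p q (π ⟨$⟩ˡ j)
  rprod-swapped : rprod A (_ ∷ Ys) ≋ λ i j → rprod A Ys i (conjugate j)
  rprod-swapped i j = begin
    rprod A (_ ∷ Ys) i j                  ≡⟨ rprod-≋ A ts i j ⟩
    A i (swapFin p q (π ⟨$⟩ˡ j))          ≡⟨ cong (A i) (inverseˡ π) ⟨
    A i (π ⟨$⟩ˡ conjugate j)              ≡⟨ rprod-≋ A ts′ i (conjugate j) ⟨
    rprod A Ys i (conjugate j)            ∎
    where open ≡-Reasoning

<ₗ-trans : ∀ {xs ys zs} → xs <ₗ ys → ys <ₗ zs → xs <ₗ zs
<ₗ-trans = <-transitive isEquivalence (resp₂ _<_) <-trans

IsBinary-resp : ∀ {n m} {A B : Matrix n m} → A ≋ B → IsBinary B → IsBinary A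
IsBinary-resp A≋B binary i j = subst Bit (sym (A≋B i j)) (binary i j)

lprod-binary : ∀ {n m} {A : Matrix n m} {Xs} → IsBinary A → All (InT n) Xs → IsBinary (lprod Xs A)
lprod-binary binary []                = binary
lprod-binary {A = A} {_ ∷ Xs} binary (t ∷ ts) with transposition-⊗ (lprod Xs A) t
... | τ , _ , X⊗≋ = IsBinary-resp X⊗≋ (lprod-binary binary ts ∘ τ)

rprod-binary : ∀ {n m} {A : Matrix n m} {Ys} → IsBinary A → All (InT m) Ys → IsBinary (rprod A Ys)
rprod-binary {A = A} binary ts = IsBinary-resp (rprod-≋ A ts) (λ i j → binary i _)

rowTransposition-step : ∀ {n m} {B : Matrix n m} {X} → IsBinary B → InT n X →
  r (X ⊗ B) <ₗ r B → c (X ⊗ B) <ₗ c B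
rowTransposition-step {B = B} binary t rX⊗B<rB with transposition-⊗ B t
... | τ , τ-transposition , X⊗B≋ =
  subst (_<ₗ c B) (sym (c-cong X⊗B≋))
    (rowSwap-r-<ₗ⇒c-<ₗ binary τ-transposition (subst (_<ₗ r B) (r-cong X⊗B≋) rX⊗B<rB))

columnTransposition-step : ∀ {n m} {A : Matrix n m} {Y Ys} → IsBinary A → All (InT m) (Y ∷ Ys) →
  c (rprod A (Y ∷ Ys)) <ₗ c (rprod A Ys) → r (rprod A (Y ∷ Ys)) <ₗ r (rprod A Ys)
columnTransposition-step {A = A} {Ys = Ys} binary ts@(_ ∷ ts′) c< with rprod-∷ A ts
... | σ , σ-transposition , rprod≋ =
  subst (_<ₗ r B) (sym (r-cong rprod≋))
    (columnSwap-c-<ₗ⇒r-<ₗ (rprod-binary binary ts′) σ-transposition (subst (_<ₗ c B) (c-cong rprod≋) c<))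
  where B = rprod A Ys

rowChain⇒c-<ₗ : ∀ {n m} {A : Matrix n m} {X Xs} → IsBinary A → All (InT n) (X ∷ Xs) →
  RowChain (X ∷ Xs) A → c (lprod (X ∷ Xs) A) <ₗ c A
rowChain⇒c-<ₗ binary (t ∷ [])           (r< , _)     = rowTransposition-step binary t r<
rowChain⇒c-<ₗ binary (t ∷ ts@(_ ∷ _)) (r< , chain) =
  <ₗ-trans (rowTransposition-step (lprod-binary binary ts) t r<) (rowChain⇒c-<ₗ binary ts chain)

columnChain⇒r-<ₗ : ∀ {n m} {A : Matrix n m} {Y Ys} → IsBinary A → All (InT m) (Y ∷ Ys) →
  ColChain A (Y ∷ Ys) → r (rprod A (Y ∷ Ys)) <ₗ r A
columnChain⇒r-<ₗ binary ts@(_ ∷ [])           (c< , _)     = columnTransposition-step binary ts c<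
columnChain⇒r-<ₗ binary ts@(_ ∷ ts′@(_ ∷ _)) (c< , chain) =
  <ₗ-trans (columnTransposition-step binary ts c<) (columnChain⇒r-<ₗ binary ts′ chain)

theorem1 : ∀ (n m : ℕ) (A : Matrix n m) → IsBinary A →
    (∀ (X : Matrix n n) (Xs : List (Matrix n n)) →
      All (InT n) (X ∷ Xs) → RowChain (X ∷ Xs) A →
      c (lprod (X ∷ Xs) A) <ₗ c A)
    ×
    (∀ (Y : Matrix m m) (Ys : List (Matrix m m)) →
      All (InT m) (Y ∷ Ys) → ColChain A (Y ∷ Ys) →
      r (rprod A (Y ∷ Ys)) <ₗ r A)
theorem1 n m A binary = (λ _ _ → rowChain⇒c-<ₗ binary) , (λ _ _ → columnChain⇒r-<ₗ binary)
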